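{- Let $k$ be a positive integer and let $G$ be a finite graph whose vertex set is partitioned into stable sets $V_1,\ldots,V_r$. If for each $i \in \{1,\ldots,r\}$ each vertex of $V_i$ has degree at most $\min\{k, |V_i| - k\}$, then for any vertex $v$ of $G$, $G$ has an ISR containing $v$.
   Context: Graphs are finite and simple. For a graph whose vertices are partitioned into stable sets $V_1,\ldots,V_r$, an independent system of representatives (ISR) is a stable set of size $r$ meeting each $V_i$ in exactly one vertex. -}

module Defs where

open import Data.Nat using (ℕ; _≤_; _+_)
open import Data.Bool using (Bool; true; false; T)
open import Data.Fin using (Fin)
open import Data.Fin.Properties using (_≟_)
open import Data.List using (List; filter; length)
open import Data.List.Base using (allFin)
open import Data.Product using (Σ; ∃; _×_)
open import Relation.Nullary using (¬_)
open import Relation.Nullary.Decidable using (⌊_⌋)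
open import Relation.Binary.PropositionalEquality using (_≡_)

record Graph (n : ℕ) : Set where
  field
    adj    : Fin n → Fin n → Bool
    sym    : ∀ u v → adj u v ≡ adj v u
    irrefl : ∀ v → adj v v ≡ false

open Graph public

Adj : ∀ {n} → Graph n → Fin n → Fin n → Set
Adj G u v = T (adj G u v)

degree : ∀ {n} → Graph n → Fin n → ℕ
degree {n} G v = length (filter (λ u → T? (adj G v u)) (allFin n))
  where
  open import Data.Bool.Properties using (T?)

-- A partition of the vertex set into r classes V_1..V_r, given by the
-- class map part : Fin n → Fin r (V_i = part ⁻¹ i).
-- Size of the class V_i.
classSize : ∀ {n r} → (Fin n → Fin r) → Fin r → ℕ
classSize {n} part i = length (filter (λ u → part u ≟ i) (allFin n))

NonemptyClasses : ∀ {n r} → (Fin n → Fin r) → Set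
NonemptyClasses {n} part = ∀ i → ∃ λ (u : Fin n) → part u ≡ i

StableClasses : ∀ {n r} → Graph n → (Fin n → Fin r) → Set
StableClasses G part = ∀ u v → part u ≡ part v → ¬ Adj G u v

-- An independent system of representatives: picks one vertex from each
-- class, the chosen vertices pairwise nonadjacent.
-- (Chosen vertices lie in distinct classes, so they are distinct and the
-- set has size exactly r.)
IsISR : ∀ {n r} → Graph n → (Fin n → Fin r) → (Fin r → Fin n) → Set
IsISR G part f = (∀ i → part (f i) ≡ i) × (∀ i j → ¬ Adj G (f i) (f j))

module Submission where

-- Haxell's alternating-tree argument. Starting from the partial ISR {v}, the classes are added one
-- at a time. To add V_root to a partial ISR f on the classes C, grow a tree: its classes are root and
-- the classes reached so far, and a new tree vertex x is a vertex of a tree class adjacent neither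
-- to v, nor to an earlier tree vertex, nor to f B for a reached class B; x then reaches the classes
-- B ∈ C outside the tree with f B adjacent to x. Such an x exists by counting: a tree vertex x
-- together with the classes B it reaches dominates at most deg x + Σ deg (f B) ≤ Σ |V_B| vertices,
-- as deg x ≤ k ≤ |V_B| - deg (f B), while v dominates at most k < |V_root| of them. If x reaches no
-- class, it takes over as the representative of its class, or completes the extension if that class
-- is root. The tree vertex that reached x's class then loses that class, and is treated the same way
-- if it has none left. The numbers of classes reached by the tree vertices, in the order they were
-- added, decrease lexicographically (extensions counting as smaller), so the process terminates.

open import Data.Bool using (T)
open import Data.Bool.Properties using (T?)
open import Data.Empty using (⊥-elim)
open import Data.Fin using (Fin)
open import Data.Fin.Properties using (_≟_)
open import Data.List using (List; []; _∷_; _++_; _∷ʳ_; length; filter; map; allFin)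
open import Data.List.Membership.Propositional using (_∈_; _∉_; find; lose)
open import Data.List.Membership.Propositional.Properties
  using (∈-filter⁺; ∈-filter⁻; ∈-++⁺ˡ; ∈-++⁺ʳ; ∈-++⁻; ∈-allFin)
open import Data.List.Properties
  using (length-++; length-filter; length-tabulate; filter-some; filter-none; filter-≐)
open import Data.List.Relation.Unary.All as All using (All; []; _∷_)
open import Data.List.Relation.Unary.All.Properties using (All¬⇒¬Any; ¬Any⇒All¬; ++⁺)
open import Data.List.Relation.Unary.AllPairs using ([]; _∷_)
open import Data.List.Relation.Unary.Any as Any using (Any; here; there; any?)
import Data.List.Relation.Unary.Any.Properties as Anyₚ
open import Data.List.Relation.Unary.Unique.Propositional using (Unique)
open import Data.List.Relation.Unary.Unique.Propositional.Properties using (filter⁺; allFin⁺)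
open import Data.Nat using (ℕ; zero; suc; _+_; _*_; _^_; _≤_; _<_; z≤n; s≤s; s≤s⁻¹)
open import Data.Nat.Induction using (<-wellFounded)
open import Data.Nat.ListAction using (sum)
open import Data.Nat.Properties hiding (_≟_)
open import Data.Product as Product using (Σ; ∃; ∃₂; _×_; _,_; proj₁; proj₂)
open import Data.Sum as Sum using (_⊎_; inj₁; inj₂; [_,_]′)
open import Data.Unit using (⊤; tt)
open import Data.Vec.Functional using (updateAt)
open import Data.Vec.Functional.Properties using (updateAt-updates; updateAt-minimal)
open import Function using (_∘_; const; id)
open import Induction.WellFounded using (Acc; acc)
open import Level using (Level; 0ℓ)
open import Relation.Binary.Definitions using (DecidableEquality)
open import Relation.Binary.PropositionalEquality
  using (_≡_; _≢_; refl; sym; trans; cong; cong₂; subst; subst₂; module ≡-Reasoning)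
open import Relation.Nullary using (¬_; Dec; yes; no; ¬?)
open import Relation.Nullary.Decidable using (_×-dec_; _⊎-dec_)
open import Relation.Unary using (Pred; Decidable; _⊆_; _≐_; _∪_)
open import Relation.Unary.Properties using (_∪?_)

open import Algebra.Properties.CommutativeSemigroup +-commutativeSemigroup
  using (x∙yz≈yx∙z; xy∙z≈xz∙y)
open import Defs hiding (sym; irrefl)

private variable a p q ℓ : Level

count : {A : Set a} {P : Pred A p} → Decidable P → List A → ℕ
count P? = length ∘ filter P?

count-none : {A : Set a} {P : Pred A p} (P? : Decidable P) → (∀ {x} → ¬ P x) →
             ∀ xs → count P? xs ≡ 0
count-none P? ¬P xs = cong length (filter-none P? (All.universal (λ _ → ¬P) xs))

count-allFin≤ : ∀ {n} {P : Pred (Fin n) p} (P? : Decidable P) → count P? (allFin n) ≤ n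
count-allFin≤ {n = n} P? = ≤-trans (length-filter P? (allFin n)) (≤-reflexive (length-tabulate id))

module _ {A : Set a} {P : Pred A p} {Q : Pred A q} (P? : Decidable P) (Q? : Decidable Q) where

  count-cong : P ≐ Q → ∀ xs → count P? xs ≡ count Q? xs
  count-cong P≐Q xs = cong length (filter-≐ P? Q? P≐Q xs)

  count-mono : P ⊆ Q → ∀ xs → count P? xs ≤ count Q? xs
  count-mono P⊆Q []       = z≤n
  count-mono P⊆Q (x ∷ xs) with P? x | Q? x
  ... | yes _  | yes _  = s≤s (count-mono P⊆Q xs)
  ... | yes Px | no ¬Qx = ⊥-elim (¬Qx (P⊆Q Px))
  ... | no _   | yes _  = m≤n⇒m≤1+n (count-mono P⊆Q xs)
  ... | no _   | no _   = count-mono P⊆Q xs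

  count-mono-< : P ⊆ Q → ∀ {x xs} → x ∈ xs → Q x → ¬ P x → count P? xs < count Q? xs
  count-mono-< P⊆Q {xs = y ∷ xs} (here refl) Qx ¬Px with P? y | Q? y
  ... | yes Px | _      = ⊥-elim (¬Px Px)
  ... | no _   | yes _  = s≤s (count-mono P⊆Q xs)
  ... | no _   | no ¬Qx = ⊥-elim (¬Qx Qx)
  count-mono-< P⊆Q {xs = y ∷ xs} (there x∈) Qx ¬Px with P? y | Q? y
  ... | yes _  | yes _  = s≤s (count-mono-< P⊆Q x∈ Qx ¬Px)
  ... | yes Py | no ¬Qy = ⊥-elim (¬Qy (P⊆Q Py))
  ... | no _   | yes _  = m≤n⇒m≤1+n (count-mono-< P⊆Q x∈ Qx ¬Px)
  ... | no _   | no _   = count-mono-< P⊆Q x∈ Qx ¬Px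

  count-∪ : ∀ xs → count (P? ∪? Q?) xs ≤ count P? xs + count Q? xs
  count-∪ []       = z≤n
  count-∪ (x ∷ xs) with P? x | Q? x
  ... | yes _ | yes _ = s≤s (≤-trans (count-∪ xs) (+-monoʳ-≤ _ (n≤1+n _)))
  ... | yes _ | no _  = s≤s (count-∪ xs)
  ... | no _  | yes _ = ≤-trans (s≤s (count-∪ xs)) (≤-reflexive (sym (+-suc _ _)))
  ... | no _  | no _  = count-∪ xs

  count-∪-disjoint : (∀ {x} → P x → ¬ Q x) →
                     ∀ xs → count (P? ∪? Q?) xs ≡ count P? xs + count Q? xs
  count-∪-disjoint P⊥Q []       = refl
  count-∪-disjoint P⊥Q (x ∷ xs) with P? x | Q? x
  ... | yes Px | yes Qx = ⊥-elim (P⊥Q Px Qx)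
  ... | yes _  | no _   = cong suc (count-∪-disjoint P⊥Q xs)
  ... | no _   | yes _  = trans (cong suc (count-∪-disjoint P⊥Q xs)) (sym (+-suc _ _))
  ... | no _   | no _   = count-∪-disjoint P⊥Q xs

  count<count⇒∃ : ∀ xs → count P? xs < count Q? xs → ∃ λ x → x ∈ xs × Q x × ¬ P x
  count<count⇒∃ (x ∷ xs) lt with P? x | Q? x
  ... | yes _  | yes _  = Product.map₂ (Product.map₁ there) (count<count⇒∃ xs (s≤s⁻¹ lt))
  ... | no ¬Px | yes Qx = x , here refl , Qx , ¬Px
  ... | yes _  | no _   = Product.map₂ (Product.map₁ there) (count<count⇒∃ xs (<⇒≤ lt))
  ... | no _   | no _   = Product.map₂ (Product.map₁ there) (count<count⇒∃ xs lt)

module _ {A : Set a} {I : Set} {R : I → Pred A ℓ} (R? : ∀ i → Decidable (R i)) where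

  count-Any : ∀ is xs →
              count (λ x → any? (λ i → R? i x) is) xs ≤ sum (map (λ i → count (R? i) xs) is)
  count-Any []       xs = ≤-reflexive (count-none _ (λ ()) xs)
  count-Any (i ∷ is) xs = begin
    count (λ x → any? (λ i → R? i x) (i ∷ is)) xs
      ≡⟨ count-cong _ _ ((λ { (here r) → inj₁ r ; (there rs) → inj₂ rs })
                        , λ { (inj₁ r) → here r ; (inj₂ rs) → there rs }) xs ⟩
    count (R? i ∪? (λ x → any? (λ i → R? i x) is)) xs
      ≤⟨ count-∪ _ _ xs ⟩
    count (R? i) xs + count (λ x → any? (λ i → R? i x) is) xs
      ≤⟨ +-monoʳ-≤ (count (R? i) xs) (count-Any is xs) ⟩
    sum (map (λ i → count (R? i) xs) (i ∷ is)) ∎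
    where open ≤-Reasoning

module _ {A B : Set} (_≟_ : DecidableEquality B) (c : A → B) where

  open import Data.List.Membership.DecPropositional _≟_ using (_∈?_)

  count-∈ : ∀ {bs} → Unique bs → ∀ xs →
            count (λ x → c x ∈? bs) xs ≡ sum (map (λ b → count (λ x → c x ≟ b) xs) bs)
  count-∈ []              xs = count-none _ (λ ()) xs
  count-∈ {b ∷ bs} (b∉bs ∷ u) xs = begin
    count (λ x → c x ∈? b ∷ bs) xs
      ≡⟨ count-cong _ _ ((λ { (here e) → inj₁ e ; (there m) → inj₂ m })
                        , λ { (inj₁ e) → here e ; (inj₂ m) → there m }) xs ⟩
    count ((λ x → c x ≟ b) ∪? (λ x → c x ∈? bs)) xs
      ≡⟨ count-∪-disjoint _ _ (λ { refl → All¬⇒¬Any b∉bs }) xs ⟩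
    count (λ x → c x ≟ b) xs + count (λ x → c x ∈? bs) xs
      ≡⟨ cong (count (λ x → c x ≟ b) xs +_) (count-∈ u xs) ⟩
    sum (map (λ b → count (λ x → c x ≟ b) xs) (b ∷ bs)) ∎
    where open ≡-Reasoning

sum-map-mono : ∀ {A : Set} {g h : A → ℕ} → (∀ a → g a ≤ h a) →
               ∀ as → sum (map g as) ≤ sum (map h as)
sum-map-mono g≤h []       = z≤n
sum-map-mono g≤h (a ∷ as) = +-mono-≤ (g≤h a) (sum-map-mono g≤h as)

infix 4 _⊏_

data _⊏_ : List ℕ → List ℕ → Set where
  here  : ∀ {d e ds es} → d < e → (d ∷ ds) ⊏ (e ∷ es)
  there : ∀ {d ds es} → ds ⊏ es → (d ∷ ds) ⊏ (d ∷ es)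

⊏-++ʳ : ∀ {ds es} fs → ds ⊏ es → ds ⊏ es ++ fs
⊏-++ʳ fs (here d<e)    = here d<e
⊏-++ʳ fs (there ds⊏es) = there (⊏-++ʳ fs ds⊏es)

⊏-∷ʳ : ∀ ds {d e} → d < e → ds ∷ʳ d ⊏ ds ∷ʳ e
⊏-∷ʳ []       d<e = here d<e
⊏-∷ʳ (_ ∷ ds) d<e = there (⊏-∷ʳ ds d<e)

module Encoding (r : ℕ) where

  base : ℕ
  base = suc (suc r)

  -- The first m entries of ds, padded with r + 1, read as digits in base r + 2. For entries at
  -- most r this turns ⊏ and proper extension into <.
  encode : ℕ → List ℕ → ℕ
  encode zero    _        = 0
  encode (suc m) []       = suc r * base ^ m + encode m []
  encode (suc m) (d ∷ ds) = d * base ^ m + encode m ds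

  private
    digit-step : ∀ m d {x} → x < base ^ m → d * base ^ m + x < suc d * base ^ m
    digit-step m d {x} x< = begin-strict
      d * base ^ m + x        <⟨ +-monoʳ-< (d * base ^ m) x< ⟩
      d * base ^ m + base ^ m ≡⟨ +-comm (d * base ^ m) (base ^ m) ⟩
      suc d * base ^ m        ∎
      where open ≤-Reasoning

  encode-< : ∀ m ds → All (_≤ r) ds → encode m ds < base ^ m
  encode-< zero    ds       _          = s≤s z≤n
  encode-< (suc m) []       _          = digit-step m (suc r) (encode-< m [] [])
  encode-< (suc m) (d ∷ ds) (d≤r ∷ ≤r) =
    <-≤-trans (digit-step m d (encode-< m ds ≤r)) (*-monoˡ-≤ (base ^ m) (s≤s (m≤n⇒m≤1+n d≤r)))

  encode-⊏ : ∀ m {ds es} → ds ⊏ es → length ds ≤ m → All (_≤ r) ds → encode m ds < encode m es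
  encode-⊏ (suc m) (here {d} {e} {ds} {es} d<e) _ (_ ∷ ≤r) = begin-strict
    d * base ^ m + encode m ds <⟨ digit-step m d (encode-< m ds ≤r) ⟩
    suc d * base ^ m           ≤⟨ *-monoˡ-≤ (base ^ m) d<e ⟩
    e * base ^ m               ≤⟨ m≤m+n (e * base ^ m) (encode m es) ⟩
    e * base ^ m + encode m es ∎
    where open ≤-Reasoning
  encode-⊏ (suc m) (there {d} ds⊏es) (s≤s len) (_ ∷ ≤r) =
    +-monoʳ-< (d * base ^ m) (encode-⊏ m ds⊏es len ≤r)

  encode-∷ʳ : ∀ m ds {d} → length (ds ∷ʳ d) ≤ m → All (_≤ r) (ds ∷ʳ d) →
              encode m (ds ∷ʳ d) < encode m ds
  encode-∷ʳ (suc m) [] {d} _ (d≤r ∷ []) = begin-strict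
    d * base ^ m + encode m []     <⟨ digit-step m d (encode-< m [] []) ⟩
    suc d * base ^ m               ≤⟨ *-monoˡ-≤ (base ^ m) (s≤s d≤r) ⟩
    suc r * base ^ m               ≤⟨ m≤m+n (suc r * base ^ m) (encode m []) ⟩
    suc r * base ^ m + encode m [] ∎
    where open ≤-Reasoning
  encode-∷ʳ (suc m) (e ∷ ds) (s≤s len) (_ ∷ ≤r) =
    +-monoʳ-< (e * base ^ m) (encode-∷ʳ m ds len ≤r)

module _ (k : ℕ) {n r : ℕ} (G : Graph n) (c : Fin n → Fin r)
         (nonempty : NonemptyClasses c)
         (deg≤k : ∀ u → degree G u ≤ k)
         (deg+k≤size : ∀ u → degree G u + k ≤ classSize c (c u))
         (v : Fin n) where

  open import Data.List.Membership.DecPropositional (_≟_ {r}) using (_∈?_)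

  infix 4 _~_ _~?_

  _~_ : Fin n → Fin n → Set
  _~_ = Adj G

  _~?_ : ∀ u w → Dec (u ~ w)
  u ~? w = T? (adj G u w)

  ~-sym : ∀ {u w} → u ~ w → w ~ u
  ~-sym {u} {w} = subst T (Graph.sym G u w)

  ~-irrefl : ∀ {u} → ¬ u ~ u
  ~-irrefl {u} = subst T (Graph.irrefl G u)

  deg : Fin n → ℕ
  deg = degree G

  size : Fin r → ℕ
  size = classSize c

  deg≡0⇒isolated : ∀ {u} → deg u ≡ 0 → ∀ w → ¬ u ~ w
  deg≡0⇒isolated {u} deg≡0 w u~w =
    <⇒≢ (filter-some (u ~?_) (Any.map (λ { refl → u~w }) (∈-allFin w))) (sym deg≡0)

  size>0 : ∀ B → 0 < size B
  size>0 B = let u , cu≡B = nonempty B in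
    filter-some (λ u → c u ≟ B) (Any.map (λ { refl → cu≡B }) (∈-allFin u))

  ‖_‖ : List (Fin r) → ℕ
  ‖ Bs ‖ = count (λ u → c u ∈? Bs) (allFin n)

  Choice : Set
  Choice = Fin r → Fin n

  record PartialISR (C : List (Fin r)) (f : Choice) : Set where
    field
      represents : ∀ i → c (f i) ≡ i
      picks-v    : f (c v) ≡ v
      v-class∈   : c v ∈ C
      stable     : ∀ {i j} → i ∈ C → j ∈ C → ¬ f i ~ f j

  open PartialISR

  PartialISR-⊆ : ∀ {C D f} → (∀ {i} → i ∈ D → i ∈ C) → c v ∈ D →
                 PartialISR C f → PartialISR D f
  PartialISR-⊆ D⊆C cv∈D isr = record
    { represents = represents isr
    ; picks-v    = picks-v isr
    ; v-class∈   = cv∈D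
    ; stable     = λ i∈ j∈ → stable isr (D⊆C i∈) (D⊆C j∈) }

  _[_]≔_ : Choice → Fin r → Fin n → Choice
  f [ A ]≔ u = updateAt f A (const u)

  reassign : ∀ {C f A u} → PartialISR C f → c u ≡ A → A ≢ c v
           → (∀ {B} → B ∈ C → B ≢ A → ¬ u ~ f B) → PartialISR (A ∷ C) (f [ A ]≔ u)
  reassign {C} {f} {A} {u} isr cu≡A A≢cv u≁C = record
    { represents = represents′
    ; picks-v    = trans (elsewhere (A≢cv ∘ sym)) (picks-v isr)
    ; v-class∈   = there (v-class∈ isr)
    ; stable     = stable′ }
    where
    f′ = f [ A ]≔ u

    updates : f′ A ≡ u
    updates = updateAt-updates A f

    elsewhere : ∀ {j} → j ≢ A → f′ j ≡ f j
    elsewhere {j} = updateAt-minimal j A f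

    represents′ : ∀ i → c (f′ i) ≡ i
    represents′ i with i ≟ A
    ... | yes refl = trans (cong c updates) cu≡A
    ... | no i≢A   = trans (cong c (elsewhere i≢A)) (represents isr i)

    u≁ : ∀ {j} → j ∈ A ∷ C → j ≢ A → ¬ u ~ f′ j
    u≁ j∈ j≢A = subst (λ w → ¬ u ~ w) (sym (elsewhere j≢A)) (u≁C (Any.tail j≢A j∈) j≢A)

    stable′ : ∀ {i j} → i ∈ A ∷ C → j ∈ A ∷ C → ¬ f′ i ~ f′ j
    stable′ {i} {j} i∈ j∈ with i ≟ A | j ≟ A
    ... | yes refl | yes refl = ~-irrefl
    ... | yes refl | no j≢A   = subst (λ w → ¬ w ~ f′ j) (sym updates) (u≁ j∈ j≢A)
    ... | no i≢A   | yes refl = subst (λ w → ¬ f′ i ~ w) (sym updates) (u≁ i∈ i≢A ∘ ~-sym)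
    ... | no i≢A   | no j≢A   = subst₂ (λ w w′ → ¬ w ~ w′) (sym (elsewhere i≢A)) (sym (elsewhere j≢A))
                                  (stable isr (Any.tail i≢A i∈) (Any.tail j≢A j∈))

  deg+k≤size-rep : ∀ (f : Choice) → (∀ i → c (f i) ≡ i) → ∀ B → deg (f B) + k ≤ size B
  deg+k≤size-rep f represents B =
    subst (λ A → deg (f B) + k ≤ size A) (represents B) (deg+k≤size (f B))

  deg+degs≤sizes : ∀ (f : Choice) → (∀ i → c (f i) ≡ i) → ∀ x Bs → 0 < length Bs
                 → deg x + sum (map (deg ∘ f) Bs) ≤ sum (map size Bs)
  deg+degs≤sizes f represents x (B ∷ Bs) _ = begin
    deg x + (deg (f B) + sum (map (deg ∘ f) Bs))
      ≡⟨ x∙yz≈yx∙z (deg x) (deg (f B)) _ ⟩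
    (deg (f B) + deg x) + sum (map (deg ∘ f) Bs)
      ≤⟨ +-mono-≤ (+-monoʳ-≤ (deg (f B)) (deg≤k x)) (sum-map-mono deg≤size Bs) ⟩
    (deg (f B) + k) + sum (map size Bs)
      ≤⟨ +-monoˡ-≤ _ (deg+k≤size-rep f represents B) ⟩
    size B + sum (map size Bs) ∎
    where
    open ≤-Reasoning
    deg≤size : ∀ B → deg (f B) ≤ size B
    deg≤size B = ≤-trans (m≤m+n _ k) (deg+k≤size-rep f represents B)

  module Augment (C : List (Fin r)) (root : Fin r) (root∉C : root ∉ C) where

    Conflict : Choice → List (Fin r) → Fin n → Pred (Fin r) 0ℓ
    Conflict f S x B = B ∈ C × B ∉ S × f B ~ x

    conflict? : ∀ f S x → Decidable (Conflict f S x)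
    conflict? f S x B = B ∈? C ×-dec ¬? (B ∈? S) ×-dec f B ~? x

    conflicts : Choice → List (Fin r) → Fin n → List (Fin r)
    conflicts f S x = filter (conflict? f S x) (allFin r)

    -- Tree vertices are listed newest first.
    reached : Choice → List (Fin n) → List (Fin r)
    reached f []      = []
    reached f (x ∷ X) = reached f X ++ conflicts f (root ∷ reached f X) x

    tree : Choice → List (Fin n) → List (Fin r)
    tree f X = root ∷ reached f X

    reachedBy : Choice → List (Fin n) → Fin n → List (Fin r)
    reachedBy f X x = conflicts f (tree f X) x

    Dominated : Choice → List (Fin n) → Pred (Fin n) 0ℓ
    Dominated f X u = v ~ u ⊎ Any (_~ u) X ⊎ Any (λ B → f B ~ u) (reached f X)

    dominated? : ∀ f X → Decidable (Dominated f X)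
    dominated? f X u = v ~? u ⊎-dec any? (_~? u) X ⊎-dec any? (λ B → f B ~? u) (reached f X)

    #dominated : Choice → List (Fin n) → ℕ
    #dominated f X = count (dominated? f X) (allFin n)

    Free : Choice → List (Fin n) → Pred (Fin n) 0ℓ
    Free f X u = c u ∈ tree f X × ¬ Dominated f X u

    Stuck : Choice → List (Fin n) → Pred (Fin n) 0ℓ
    Stuck f X u = ∀ B → ¬ Conflict f (tree f X) u B

    Valid : Choice → List (Fin n) → Set
    Valid f []      = ⊤
    Valid f (x ∷ X) = Valid f X × Free f X x × 0 < length (reachedBy f X x)

    profile : Choice → List (Fin n) → List ℕ
    profile f []      = []
    profile f (x ∷ X) = profile f X ∷ʳ length (reachedBy f X x)

    ∈-conflicts⁻ : ∀ {f S x B} → B ∈ conflicts f S x → Conflict f S x B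
    ∈-conflicts⁻ {f} {S} {x} = proj₂ ∘ ∈-filter⁻ (conflict? f S x) {xs = allFin r}

    ∈-conflicts⁺ : ∀ {f S x B} → Conflict f S x B → B ∈ conflicts f S x
    ∈-conflicts⁺ {f} {S} {x} {B} = ∈-filter⁺ (conflict? f S x) (∈-allFin B)

    stuck⊎reaching : ∀ f X u → Stuck f X u ⊎ 0 < length (reachedBy f X u)
    stuck⊎reaching f X u with any? (conflict? f (tree f X) u) (allFin r)
    ... | yes some = inj₂ (filter-some (conflict? f (tree f X) u) some)
    ... | no none  = inj₁ λ B conflict → none (lose (∈-allFin B) conflict)

    Dominated-∷⁺ : ∀ {f x X u} → Dominated f X u → Dominated f (x ∷ X) u
    Dominated-∷⁺ (inj₁ v~u)              = inj₁ v~u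
    Dominated-∷⁺ (inj₂ (inj₁ X~u))       = inj₂ (inj₁ (there X~u))
    Dominated-∷⁺ (inj₂ (inj₂ reached~u)) = inj₂ (inj₂ (Anyₚ.++⁺ˡ reached~u))

    Dominated-∷⁻ : ∀ {f x X} → Dominated f (x ∷ X)
                 ⊆ Dominated f X ∪ (x ~_) ∪ (λ u → Any (λ B → f B ~ u) (reachedBy f X x))
    Dominated-∷⁻ (inj₁ v~u)                = inj₁ (inj₁ v~u)
    Dominated-∷⁻ (inj₂ (inj₁ (here x~u)))  = inj₂ (inj₁ x~u)
    Dominated-∷⁻ (inj₂ (inj₁ (there X~u))) = inj₁ (inj₂ (inj₁ X~u))
    Dominated-∷⁻ {f} {X = X} (inj₂ (inj₂ reached~u)) with Anyₚ.++⁻ (reached f X) reached~u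
    ... | inj₁ old~u = inj₁ (inj₂ (inj₂ old~u))
    ... | inj₂ new~u = inj₂ (inj₂ new~u)

    ‖tree-∷‖ : ∀ f x X → ‖ tree f (x ∷ X) ‖ ≡ ‖ tree f X ‖ + sum (map size (reachedBy f X x))
    ‖tree-∷‖ f x X = begin
      count (λ u → c u ∈? tree f X ++ Y) (allFin n)
        ≡⟨ count-cong _ _ (∈-++⁻ (tree f X) , [ ∈-++⁺ˡ , ∈-++⁺ʳ (tree f X) ]′) (allFin n) ⟩
      count ((λ u → c u ∈? tree f X) ∪? (λ u → c u ∈? Y)) (allFin n)
        ≡⟨ count-∪-disjoint _ _ (λ u∈tree u∈Y → proj₁ (proj₂ (∈-conflicts⁻ u∈Y)) u∈tree)
                            (allFin n) ⟩
      ‖ tree f X ‖ + ‖ Y ‖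
        ≡⟨ cong (‖ tree f X ‖ +_)
                (count-∈ _≟_ c (filter⁺ (conflict? f (tree f X) x) (allFin⁺ r)) (allFin n)) ⟩
      ‖ tree f X ‖ + sum (map size Y) ∎
      where
      open ≡-Reasoning
      Y = reachedBy f X x

    #dominated-∷ : ∀ {f} x X → (∀ i → c (f i) ≡ i) → 0 < length (reachedBy f X x)
                 → #dominated f (x ∷ X) ≤ #dominated f X + sum (map size (reachedBy f X x))
    #dominated-∷ {f} x X represents reaching = begin
      #dominated f (x ∷ X)
        ≤⟨ count-mono _ _ Dominated-∷⁻ V ⟩
      count (dominated? f X ∪? (x ~?_) ∪? anyY?) V
        ≤⟨ count-∪ _ _ V ⟩
      #dominated f X + count ((x ~?_) ∪? anyY?) V
        ≤⟨ +-monoʳ-≤ _ (≤-trans (count-∪ _ _ V)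
                                (+-monoʳ-≤ (deg x) (count-Any (λ B → f B ~?_) Y V))) ⟩
      #dominated f X + (deg x + sum (map (deg ∘ f) Y))
        ≤⟨ +-monoʳ-≤ _ (deg+degs≤sizes f represents x Y reaching) ⟩
      #dominated f X + sum (map size Y) ∎
      where
      open ≤-Reasoning
      V = allFin n
      Y = reachedBy f X x
      anyY? = λ u → any? (λ B → f B ~? u) Y

    #dominated+size≤‖tree‖+k : ∀ {f} X → PartialISR C f → Valid f X
                             → #dominated f X + size root ≤ ‖ tree f X ‖ + k
    #dominated+size≤‖tree‖+k {f} [] _ _ = begin
      #dominated f [] + size root
        ≡⟨ cong₂ _+_ (count-cong _ _ (only-v , inj₁) (allFin n))
                     (count-cong _ _ (here , λ { (here e) → e }) (allFin n)) ⟩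
      deg v + ‖ tree f [] ‖ ≡⟨ +-comm (deg v) _ ⟩
      ‖ tree f [] ‖ + deg v ≤⟨ +-monoʳ-≤ _ (deg≤k v) ⟩
      ‖ tree f [] ‖ + k     ∎
      where
      open ≤-Reasoning
      only-v : Dominated f [] ⊆ (v ~_)
      only-v (inj₁ v~u)          = v~u
      only-v (inj₂ (inj₁ ()))
      only-v (inj₂ (inj₂ ()))
    #dominated+size≤‖tree‖+k {f} (x ∷ X) isr (valid , _ , reaching) = begin
      #dominated f (x ∷ X) + size root ≤⟨ +-monoˡ-≤ _ (#dominated-∷ x X (represents isr) reaching) ⟩
      (#dominated f X + s) + size root ≡⟨ xy∙z≈xz∙y (#dominated f X) s (size root) ⟩
      (#dominated f X + size root) + s ≤⟨ +-monoˡ-≤ s (#dominated+size≤‖tree‖+k X isr valid) ⟩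
      (‖ tree f X ‖ + k) + s           ≡⟨ xy∙z≈xz∙y ‖ tree f X ‖ k s ⟩
      (‖ tree f X ‖ + s) + k           ≡⟨ cong (_+ k) (‖tree-∷‖ f x X) ⟨
      ‖ tree f (x ∷ X) ‖ + k           ∎
      where
      open ≤-Reasoning
      s = sum (map size (reachedBy f X x))

    free-vertex : ∀ {f} X → PartialISR C f → Valid f X → k < size root → ∃ (Free f X)
    free-vertex {f} X isr valid k<root =
      let u , _ , u∈tree , ¬dom =
            count<count⇒∃ (dominated? f X) (λ u → c u ∈? tree f X) (allFin n) dominated<tree
      in u , u∈tree , ¬dom
      where
      dominated<tree : #dominated f X < ‖ tree f X ‖
      dominated<tree = +-cancelʳ-≤ k _ _ (begin
        suc (#dominated f X) + k    ≡⟨ +-suc _ k ⟨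
        #dominated f X + suc k      ≤⟨ +-monoʳ-≤ _ k<root ⟩
        #dominated f X + size root  ≤⟨ #dominated+size≤‖tree‖+k X isr valid ⟩
        ‖ tree f X ‖ + k            ∎)
        where open ≤-Reasoning

    length≤‖tree‖ : ∀ {f} X → Valid f X → length X ≤ ‖ tree f X ‖
    length≤‖tree‖ []      _ = z≤n
    length≤‖tree‖ {f} (x ∷ X) (valid , _ , reaching) = begin
      suc (length X)                  ≡⟨ +-comm 1 (length X) ⟩
      length X + 1                    ≤⟨ +-mono-≤ (length≤‖tree‖ X valid) (sum-size>0 Y reaching) ⟩
      ‖ tree f X ‖ + sum (map size Y) ≡⟨ ‖tree-∷‖ f x X ⟨
      ‖ tree f (x ∷ X) ‖              ∎
      where
      open ≤-Reasoning
      Y = reachedBy f X x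
      sum-size>0 : ∀ Bs → 0 < length Bs → 0 < sum (map size Bs)
      sum-size>0 (B ∷ _) _ = ≤-trans (size>0 B) (m≤m+n _ _)

    length-profile : ∀ f X → length (profile f X) ≡ length X
    length-profile f []      = refl
    length-profile f (x ∷ X) =
      trans (length-++ (profile f X)) (trans (+-comm _ 1) (cong suc (length-profile f X)))

    profile≤r : ∀ f X → All (_≤ r) (profile f X)
    profile≤r f []      = []
    profile≤r f (x ∷ X) = ++⁺ (profile≤r f X) (count-allFin≤ (conflict? f (tree f X) x) ∷ [])

    module _ {f : Choice} {A : Fin r} {u : Fin n} where

      private
        f′ = f [ A ]≔ u

        elsewhere : ∀ {B} → B ≢ A → f′ B ≡ f B
        elsewhere {B} = updateAt-minimal B A f

        x≁u⇒¬f′A~x : ∀ {x} → ¬ x ~ u → ¬ f′ A ~ x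
        x≁u⇒¬f′A~x {x} x≁u f′A~x = x≁u (~-sym (subst (_~ x) (updateAt-updates A f) f′A~x))

      Conflict-≔ : ∀ {S x} → ¬ x ~ u → Conflict f′ S x ⊆ Conflict f S x
      Conflict-≔ {x = x} x≁u {B} (B∈C , B∉S , f′B~x) with B ≟ A
      ... | yes refl = ⊥-elim (x≁u⇒¬f′A~x x≁u f′B~x)
      ... | no B≢A   = B∈C , B∉S , subst (_~ x) (elsewhere B≢A) f′B~x

      conflicts-≔ : ∀ {S x} → ¬ x ~ u → A ∉ conflicts f S x → conflicts f′ S x ≡ conflicts f S x
      conflicts-≔ {S} {x} x≁u A∉ =
        filter-≐ (conflict? f′ S x) (conflict? f S x) (Conflict-≔ x≁u , ≔-Conflict) (allFin r)
        where
        ≔-Conflict : Conflict f S x ⊆ Conflict f′ S x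
        ≔-Conflict {B} conflict@(B∈C , B∉S , fB~x) with B ≟ A
        ... | yes refl = ⊥-elim (A∉ (∈-conflicts⁺ conflict))
        ... | no B≢A   = B∈C , B∉S , subst (_~ x) (sym (elsewhere B≢A)) fB~x

      conflicts-≔-shorter : ∀ {S x} → ¬ x ~ u → A ∈ conflicts f S x
                          → length (conflicts f′ S x) < length (conflicts f S x)
      conflicts-≔-shorter {S} {x} x≁u A∈ =
        count-mono-< (conflict? f′ S x) (conflict? f S x) (Conflict-≔ x≁u) (∈-allFin A) (∈-conflicts⁻ A∈)
          (x≁u⇒¬f′A~x x≁u ∘ proj₂ ∘ proj₂)

      reached-≔ : ∀ X → A ∉ reached f X → All (λ x → ¬ x ~ u) X → reached f′ X ≡ reached f X
      reachedBy-≔ : ∀ x X → A ∉ reached f (x ∷ X) → All (λ x → ¬ x ~ u) (x ∷ X)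
                  → reachedBy f′ X x ≡ reachedBy f X x

      reached-≔ []      _  _                = refl
      reached-≔ (x ∷ X) A∉ X≁u@(_ ∷ X≁u′) =
        cong₂ _++_ (reached-≔ X (A∉ ∘ ∈-++⁺ˡ) X≁u′) (reachedBy-≔ x X A∉ X≁u)

      reachedBy-≔ x X A∉ (x≁u ∷ X≁u) = begin
        conflicts f′ (tree f′ X) x ≡⟨ cong (λ R → conflicts f′ (root ∷ R) x)
                                          (reached-≔ X (A∉ ∘ ∈-++⁺ˡ) X≁u) ⟩
        conflicts f′ (tree f X) x  ≡⟨ conflicts-≔ x≁u (A∉ ∘ ∈-++⁺ʳ (reached f X)) ⟩
        conflicts f (tree f X) x   ∎
        where open ≡-Reasoning

      profile-≔ : ∀ X → A ∉ reached f X → All (λ x → ¬ x ~ u) X → profile f′ X ≡ profile f X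
      profile-≔ []      _  _                = refl
      profile-≔ (x ∷ X) A∉ X≁u@(_ ∷ X≁u′) =
        cong₂ _∷ʳ_ (profile-≔ X (A∉ ∘ ∈-++⁺ˡ) X≁u′) (cong length (reachedBy-≔ x X A∉ X≁u))

      Free-≔ : ∀ X {w} → A ∉ reached f X → All (λ x → ¬ x ~ u) X → Free f X w → Free f′ X w
      Free-≔ X {w} A∉ X≁u (w∈tree , ¬dom) =
        subst (λ R → c w ∈ root ∷ R) (sym reached≡) w∈tree , ¬dom ∘ undo
        where
        reached≡ = reached-≔ X A∉ X≁u
        undo : Dominated f′ X w → Dominated f X w
        undo (inj₁ v~w)        = inj₁ v~w
        undo (inj₂ (inj₁ X~w)) = inj₂ (inj₁ X~w)
        undo (inj₂ (inj₂ R~w)) =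
          let B , B∈ , f′B~w = find (subst (Any (λ B → f′ B ~ w)) reached≡ R~w)
              B≢A = λ B≡A → A∉ (subst (_∈ reached f X) B≡A B∈)
          in inj₂ (inj₂ (lose B∈ (subst (_~ w) (elsewhere B≢A) f′B~w)))

      Valid-≔ : ∀ X → A ∉ reached f X → All (λ x → ¬ x ~ u) X → Valid f X → Valid f′ X
      Valid-≔ []      _  _                _                          = tt
      Valid-≔ (x ∷ X) A∉ X≁u@(_ ∷ X≁u′) (valid , x-free , reaching) =
        Valid-≔ X A∉′ X≁u′ valid , Free-≔ X A∉′ X≁u′ x-free ,
        subst (λ Y → 0 < length Y) (sym (reachedBy-≔ x X A∉ X≁u)) reaching
        where A∉′ = A∉ ∘ ∈-++⁺ˡ

    Stuck-∷⁻ : ∀ {f x X u} → Free f (x ∷ X) u → Stuck f (x ∷ X) u → Stuck f X u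
    Stuck-∷⁻ {f} {x} {X} (_ , ¬dom) stuck B (B∈C , B∉tree , fB~u) with B ∈? reachedBy f X x
    ... | yes B∈Y = ¬dom (inj₂ (inj₂ (lose (∈-++⁺ʳ (reached f X) B∈Y) fB~u)))
    ... | no B∉Y  = stuck B (B∈C , [ B∉tree , B∉Y ]′ ∘ ∈-++⁻ (tree f X) , fB~u)

    free∧stuck⇒independent : ∀ {f X u} → Free f X u → Stuck f X u → ∀ {B} → B ∈ C → ¬ u ~ f B
    free∧stuck⇒independent {f} {X} (_ , ¬dom) stuck {B} B∈C u~fB with B ∈? reached f X
    ... | yes B∈R = ¬dom (inj₂ (inj₂ (lose B∈R (~-sym u~fB))))
    ... | no B∉R  = stuck B (B∈C , B∉tree , ~-sym u~fB)
      where
      B∉tree : B ∉ tree f X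
      B∉tree (here refl)  = root∉C B∈C
      B∉tree (there B∈R) = B∉R B∈R

    root≢v-class : ∀ {f} → PartialISR C f → root ≢ c v
    root≢v-class isr root≡cv = root∉C (subst (_∈ C) (sym root≡cv) (v-class∈ isr))

    v-class∉conflicts : ∀ {f S x} → PartialISR C f → ¬ v ~ x → c v ∉ conflicts f S x
    v-class∉conflicts {x = x} isr v≁x cv∈ =
      v≁x (subst (_~ x) (picks-v isr) (proj₂ (proj₂ (∈-conflicts⁻ cv∈))))

    record Reassigned (f : Choice) (x : Fin n) (X : List (Fin n)) (f′ : Choice) : Set where
      field
        isr′     : PartialISR C f′
        valid′   : Valid f′ X
        x-free′  : Free f′ X x
        profile≡ : profile f′ X ≡ profile f X
        shorter  : length (reachedBy f′ X x) < length (reachedBy f X x)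

    reassign-reached : ∀ {f x X u} → PartialISR C f → Valid f (x ∷ X)
                     → Free f (x ∷ X) u → Stuck f (x ∷ X) u → c u ∈ reachedBy f X x
                     → Reassigned f x X (f [ c u ]≔ u)
    reassign-reached {f} {x} {X} {u} isr (valid , x-free , _) u-free@(_ , ¬dom) stuck A∈Y = record
      { isr′     = PartialISR-⊆ there (v-class∈ isr)
                     (reassign isr refl A≢cv λ B∈C _ → free∧stuck⇒independent u-free stuck B∈C)
      ; valid′   = Valid-≔ X A∉R X≁u valid
      ; x-free′  = Free-≔ X A∉R X≁u x-free
      ; profile≡ = profile-≔ X A∉R X≁u
      ; shorter  = subst (λ R → length (conflicts (f [ c u ]≔ u) (root ∷ R) x) < length (reachedBy f X x))
                         (sym (reached-≔ X A∉R X≁u)) (conflicts-≔-shorter x≁u A∈Y) }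
      where
      A∉R : c u ∉ reached f X
      A∉R = proj₁ (proj₂ (∈-conflicts⁻ A∈Y)) ∘ there
      xX≁u : All (λ y → ¬ y ~ u) (x ∷ X)
      xX≁u = ¬Any⇒All¬ (x ∷ X) (¬dom ∘ inj₂ ∘ inj₁)
      x≁u = All.head xX≁u
      X≁u = All.tail xX≁u
      A≢cv : c u ≢ c v
      A≢cv cu≡cv =
        v-class∉conflicts isr (proj₂ x-free ∘ inj₁) (subst (_∈ reachedBy f X x) cu≡cv A∈Y)

    Extended : Set
    Extended = ∃ (PartialISR (root ∷ C))

    Improved : Choice → List (Fin n) → Set
    Improved f X = ∃₂ λ f′ X′ → PartialISR C f′ × Valid f′ X′ × profile f′ X′ ⊏ profile f X

    Improved-∷ : ∀ {f g} x X → profile g X ≡ profile f X → Improved g X → Improved f (x ∷ X)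
    Improved-∷ x X profile≡ (f′ , X′ , isr′ , valid′ , ⊏g) =
      f′ , X′ , isr′ , valid′ , ⊏-++ʳ _ (subst (_ ⊏_) profile≡ ⊏g)

    Reassigned⇒Improved : ∀ {f f′ x X} → Reassigned f x X f′ → 0 < length (reachedBy f′ X x)
                        → Improved f (x ∷ X)
    Reassigned⇒Improved {f} {f′} {x} {X} reassigned reaching =
      f′ , x ∷ X , isr′ , (valid′ , x-free′ , reaching) ,
      subst (λ P → P ∷ʳ length (reachedBy f′ X x) ⊏ profile f (x ∷ X)) (sym profile≡)
            (⊏-∷ʳ (profile f X) shorter)
      where open Reassigned reassigned

    -- u's class is root, which completes the extension, or was reached by some tree vertex x; then
    -- u becomes its representative, so x reaches one class fewer, and is swapped in turn if stuck.
    swap : ∀ X {f u} → PartialISR C f → Valid f X → Free f X u → Stuck f X u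
         → Extended ⊎ Improved f X
    swap [] {f} {u} isr _ u-free@(here cu≡root , _) stuck =
      inj₁ (f [ root ]≔ u , reassign isr cu≡root (root≢v-class isr)
                              λ B∈C _ → free∧stuck⇒independent u-free stuck B∈C)
    swap (x ∷ X) {f} {u} isr valid@(validX , _ , _) u-free@(cu∈tree , ¬dom) stuck
      with ∈-++⁻ (tree f X) cu∈tree
    ... | inj₁ cu∈treeX = Sum.map₂ (Improved-∷ x X refl)
                            (swap X isr validX (cu∈treeX , ¬dom ∘ Dominated-∷⁺) (Stuck-∷⁻ u-free stuck))
    ... | inj₂ cu∈Y with reassign-reached isr valid u-free stuck cu∈Y
    ...   | reassigned with stuck⊎reaching (f [ c u ]≔ u) X x
    ...     | inj₁ x-stuck = Sum.map₂ (Improved-∷ x X profile≡) (swap X isr′ valid′ x-free′ x-stuck)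
      where open Reassigned reassigned
    ...     | inj₂ reaching = inj₂ (Reassigned⇒Improved reassigned reaching)

    measure : Choice → List (Fin n) → ℕ
    measure f X = Encoding.encode r n (profile f X)

    length-profile≤n : ∀ {f} X → Valid f X → length (profile f X) ≤ n
    length-profile≤n {f} X valid = begin
      length (profile f X) ≡⟨ length-profile f X ⟩
      length X             ≤⟨ length≤‖tree‖ X valid ⟩
      ‖ tree f X ‖         ≤⟨ count-allFin≤ (λ u → c u ∈? tree f X) ⟩
      n                    ∎
      where open ≤-Reasoning

    measure-∷ : ∀ {f x} X → Valid f (x ∷ X) → measure f (x ∷ X) < measure f X
    measure-∷ {f} {x} X valid =
      Encoding.encode-∷ʳ r n (profile f X) (length-profile≤n (x ∷ X) valid) (profile≤r f (x ∷ X))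

    measure-⊏ : ∀ {f f′} X {X′} → Valid f′ X′ → profile f′ X′ ⊏ profile f X
              → measure f′ X′ < measure f X
    measure-⊏ {f′ = f′} X {X′} valid′ ⊏f =
      Encoding.encode-⊏ r n ⊏f (length-profile≤n X′ valid′) (profile≤r f′ X′)

    module Grow (k<size : k < size root) where

      grow : ∀ {f} X → PartialISR C f → Valid f X → Acc _<_ (measure f X) → Extended
      grow {f} X isr valid (acc smaller) with free-vertex X isr valid k<size
      ... | u , u-free with stuck⊎reaching f X u
      ...   | inj₂ reaching = grow (u ∷ X) isr valid′ (smaller (measure-∷ X valid′))
        where valid′ = valid , u-free , reaching
      ...   | inj₁ u-stuck with swap X isr valid u-free u-stuck
      ...     | inj₁ extended                       = extended
      ...     | inj₂ (f′ , X′ , isr′ , valid′ , ⊏f) =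
        grow X′ isr′ valid′ (smaller (measure-⊏ X valid′ ⊏f))

    -- grow needs k < |V_root|, which holds once a vertex of V_root has a neighbour; an isolated
    -- vertex of V_root can be added directly.
    augment : ∀ {f} → PartialISR C f → Extended
    augment {f} isr with nonempty root
    ... | u₀ , cu₀≡root with deg u₀ in deg≡
    ... | zero  = f [ root ]≔ u₀ , reassign isr cu₀≡root (root≢v-class isr)
                                     λ _ _ → deg≡0⇒isolated deg≡ _
    ... | suc d = Grow.grow k<size [] isr tt (<-wellFounded _)
      where
      k<size : k < size root
      k<size = ≤-trans (s≤s (m≤n+m k d))
        (subst (λ B → suc d + k ≤ size B) cu₀≡root
               (subst (λ e → e + k ≤ size (c u₀)) deg≡ (deg+k≤size u₀)))

  extend : ∀ Cs {C f} → PartialISR C f → ∃ (PartialISR (Cs ++ C))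
  extend []       isr = _ , isr
  extend (i ∷ Cs) {C} isr with extend Cs isr
  ... | f , isr′ with i ∈? Cs ++ C
  ...   | yes i∈ = f , PartialISR-⊆ (λ { (here refl) → i∈ ; (there j∈) → j∈ })
                                     (there (v-class∈ isr′)) isr′
  ...   | no i∉  = Augment.augment (Cs ++ C) i i∉ isr′

  start : ∃ (PartialISR (c v ∷ []))
  start = pick [ c v ]≔ v , record
    { represents = represents′
    ; picks-v    = updateAt-updates (c v) pick
    ; v-class∈   = here refl
    ; stable     = λ { (here refl) (here refl) → ~-irrefl } }
    where
    pick : Choice
    pick = proj₁ ∘ nonempty
    represents′ : ∀ i → c ((pick [ c v ]≔ v) i) ≡ i
    represents′ i with i ≟ c v
    ... | yes refl = cong c (updateAt-updates (c v) pick)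
    ... | no i≢cv  = trans (cong c (updateAt-minimal i (c v) pick i≢cv)) (proj₂ (nonempty i))

  isr-through : Σ Choice λ f → IsISR G c f × f (c v) ≡ v
  isr-through =
    let f , isr = extend (allFin r) (proj₂ start)
        all∈    = λ i → ∈-++⁺ˡ (∈-allFin i)
    in f , (represents isr , λ i j → stable isr (all∈ i) (all∈ j)) , picks-v isr

theorem5 : (k : ℕ) → 0 < k → (n r : ℕ) → (G : Graph n) → (part : Fin n → Fin r)
    → NonemptyClasses part → StableClasses G part
    → (∀ (u : Fin n) → degree G u ≤ k × degree G u + k ≤ classSize part (part u))
    → (v : Fin n) → Σ (Fin r → Fin n) λ f → IsISR G part f × f (part v) ≡ v
theorem5 k _ n r G part nonempty _ bounds v =
  isr-through k G part nonempty (proj₁ ∘ bounds) (proj₂ ∘ bounds) v
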